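{- If $T_x$ is a rooted tree, then $\chi_D(T_x)\le D(T_x)+1$.
   Context: A rooted tree $T_x$ is a tree with distinguished root $x$; its automorphisms are the tree automorphisms fixing $x$. A coloring is distinguishing if no nontrivial automorphism preserves all vertex colors, and proper if adjacent vertices receive different colors. $D(T_x)$ is the minimum number of colors in a distinguishing coloring of $T_x$, and $\chi_D(T_x)$ is the minimum number of colors in a proper distinguishing coloring of $T_x$. -}

module Defs where

open import Data.Nat using (ℕ; _≤_; _+_)
open import Data.Fin using (Fin)
open import Data.Bool using (Bool; T)
open import Data.List using (List; []; _∷_; length; _∷ʳ_)
open import Data.List.Relation.Unary.Linked using (Linked)
open import Data.List.Relation.Unary.Unique.Propositional using (Unique)
open import Data.Fin.Permutation using (Permutation′; _⟨$⟩ʳ_)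
open import Data.Product using (Σ; _×_)
open import Relation.Binary.PropositionalEquality using (_≡_; _≢_)
open import Relation.Nullary using (¬_)

record Graph (n : ℕ) : Set where
  field
    adj    : Fin n → Fin n → Bool
    sym    : ∀ u v → adj u v ≡ adj v u
    irrefl : ∀ v → adj v v ≡ Data.Bool.false

open Graph public

Edge : ∀ {n} → Graph n → Fin n → Fin n → Set
Edge G u v = T (adj G u v)

data Walk {n : ℕ} (G : Graph n) : Fin n → Fin n → Set where
  []  : ∀ {u} → Walk G u u
  _∷_ : ∀ {u v w} → Edge G u v → Walk G v w → Walk G u w

Connected : ∀ {n} → Graph n → Set
Connected G = ∀ u v → Walk G u v

IsCycle : ∀ {n} → Graph n → Fin n → List (Fin n) → Set
IsCycle G u ws = (2 ≤ length ws) × Unique (u ∷ ws) × Linked (Edge G) ((u ∷ ws) ∷ʳ u)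

Acyclic : ∀ {n} → Graph n → Set
Acyclic G = ∀ u ws → ¬ IsCycle G u ws

IsTree : ∀ {n} → Graph n → Set
IsTree G = Connected G × Acyclic G

IsRootedAut : ∀ {n} → Graph n → Fin n → Permutation′ n → Set
IsRootedAut G x σ = (∀ u v → adj G (σ ⟨$⟩ʳ u) (σ ⟨$⟩ʳ v) ≡ adj G u v) × (σ ⟨$⟩ʳ x ≡ x)

Coloring : ℕ → ℕ → Set
Coloring n k = Fin n → Fin k

Distinguishing : ∀ {n k} → Graph n → Fin n → Coloring n k → Set
Distinguishing {n} G x c =
  (σ : Permutation′ n) → IsRootedAut G x σ →
  (∀ v → c (σ ⟨$⟩ʳ v) ≡ c v) → ∀ v → σ ⟨$⟩ʳ v ≡ v

Proper : ∀ {n k} → Graph n → Coloring n k → Set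
Proper G c = ∀ u v → Edge G u v → c u ≢ c v

HasDistColoring : ∀ {n} → Graph n → Fin n → ℕ → Set
HasDistColoring {n} G x k = Σ (Coloring n k) (Distinguishing G x)

HasProperDistColoring : ∀ {n} → Graph n → Fin n → ℕ → Set
HasProperDistColoring {n} G x k =
  Σ (Coloring n k) (λ c → Proper G c × Distinguishing G x c)

IsDistNumber : ∀ {n} → Graph n → Fin n → ℕ → Set
IsDistNumber G x d = HasDistColoring G x d × (∀ k → HasDistColoring G x k → d ≤ k)

IsDistChromNumber : ∀ {n} → Graph n → Fin n → ℕ → Set
IsDistChromNumber G x d =
  HasProperDistColoring G x d × (∀ k → HasProperDistColoring G x k → d ≤ k)

module Submission where

-- Take a distinguishing colouring c with d colours and repaint the tree from
-- the root outwards: the root keeps its colour, and a vertex v of depth k+1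
-- keeps c v unless that clashes with the (already repainted) colour of its
-- parent, in which case it gets the fresh colour ν.  Every edge of a tree
-- joins a vertex to its parent, so the new colouring is proper; and since
-- "keep c v unless it equals q" is injective in c v for fixed q, a
-- root-fixing automorphism preserving the new colours (hence preserving
-- depths and commuting with the parent map) also preserves c, so it is the
-- identity.

open import Defs hiding (sym)
open import Data.Nat using (ℕ; zero; suc; _≤_; _+_; z≤n; s≤s; s≤s⁻¹)
open import Data.Nat.Properties
  using (≤-antisym; ≤-refl; ≤-reflexive; ≤-trans; n≤1+n; <-irrefl; <-cmp; _≤?_; ≰⇒>)
open import Data.Fin as Fin using (Fin; _≟_; _↑ˡ_; _↑ʳ_; splitAt)
open import Data.Fin.Properties using (any?; ↑ˡ-injective; splitAt-↑ˡ; splitAt-↑ʳ)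
open import Data.Fin.Permutation
  using (Permutation′; _⟨$⟩ʳ_; _⟨$⟩ˡ_; flip; inverseˡ; inverseʳ)
open import Data.Bool using (T)
open import Data.Bool.Properties using (T?)
open import Data.List using (List; []; _∷_; length; _∷ʳ_)
open import Data.List.Relation.Unary.All as All using (All; []; _∷_)
open import Data.List.Relation.Unary.All.Properties using (∷ʳ⁺)
open import Data.List.Relation.Unary.AllPairs using ([]; _∷_)
open import Data.List.Relation.Unary.Linked using (Linked; [-]; _∷_)
open import Data.List.Relation.Unary.Unique.Propositional using (Unique)
open import Data.Product using (Σ; ∃; _×_; _,_; proj₁; proj₂)
open import Data.Sum using (_⊎_; inj₁; inj₂)
open import Data.Empty using (⊥; ⊥-elim)
open import Relation.Nullary using (Dec; yes; no)
open import Relation.Nullary.Decidable using (_×-dec_; _⊎-dec_)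
open import Relation.Binary using (tri<; tri≈; tri>)
open import Relation.Binary.PropositionalEquality
  using (_≡_; _≢_; refl; sym; trans; cong; subst; ≢-sym; module ≡-Reasoning)

module _ {A : Set} where

  Linked-∷ʳ : {R : A → A → Set} (xs : List A) (y z : A) →
              Linked R (xs ∷ʳ y) → R y z → Linked R (xs ∷ʳ y ∷ʳ z)
  Linked-∷ʳ []           y z _          ryz = ryz ∷ [-]
  Linked-∷ʳ (a ∷ [])     y z (ray ∷ [-]) ryz = ray ∷ ryz ∷ [-]
  Linked-∷ʳ (a ∷ b ∷ xs) y z (rab ∷ l)  ryz = rab ∷ Linked-∷ʳ (b ∷ xs) y z l ryz

  Unique-∷ʳ : (xs : List A) (y : A) → Unique xs → All (_≢ y) xs → Unique (xs ∷ʳ y)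
  Unique-∷ʳ []       y []       []       = [] ∷ []
  Unique-∷ʳ (a ∷ xs) y (a∉ ∷ u) (a≢y ∷ ≢y) = ∷ʳ⁺ a∉ a≢y ∷ Unique-∷ʳ xs y u ≢y

  length-∷ʳ-positive : (xs : List A) (y : A) → 1 ≤ length (xs ∷ʳ y)
  length-∷ʳ-positive []       y = s≤s z≤n
  length-∷ʳ-positive (a ∷ xs) y = s≤s z≤n

module _ {n : ℕ} (G : Graph n) where

  edge-sym : ∀ {u v} → Edge G u v → Edge G v u
  edge-sym {u} {v} = subst T (Graph.sym G u v)

  edge-≢ : ∀ {u v} → Edge G u v → u ≢ v
  edge-≢ {u} e refl = subst T (Graph.irrefl G u) e

module _ {n : ℕ} (G : Graph n) (x : Fin n) (σ : Permutation′ n) (aut : IsRootedAut G x σ) where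

  aut-edge : ∀ {u v} → Edge G u v → Edge G (σ ⟨$⟩ʳ u) (σ ⟨$⟩ʳ v)
  aut-edge {u} {v} = subst T (sym (proj₁ aut u v))

  inverse-aut : IsRootedAut G x (flip σ)
  inverse-aut = preserves⁻¹ , root⁻¹
    where
      open ≡-Reasoning
      τ = σ ⟨$⟩ˡ_
      preserves⁻¹ : ∀ u v → adj G (τ u) (τ v) ≡ adj G u v
      preserves⁻¹ u v = begin
        adj G (τ u) (τ v)                         ≡⟨ sym (proj₁ aut (τ u) (τ v)) ⟩
        adj G (σ ⟨$⟩ʳ τ u) (σ ⟨$⟩ʳ τ v)           ≡⟨ cong (λ w → adj G w (σ ⟨$⟩ʳ τ v)) (inverseʳ σ) ⟩
        adj G u (σ ⟨$⟩ʳ τ v)                      ≡⟨ cong (adj G u) (inverseʳ σ) ⟩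
        adj G u v                                 ∎
      root⁻¹ : τ x ≡ x
      root⁻¹ = trans (cong τ (sym (proj₂ aut))) (inverseˡ σ)

module Depth {n : ℕ} (G : Graph n) (x : Fin n) (conn : Connected G) where

  E : Fin n → Fin n → Set
  E = Edge G

  Within : ℕ → Fin n → Set
  Within zero    v = v ≡ x
  Within (suc k) v = Within k v ⊎ ∃ λ u → Within k u × E u v

  within? : ∀ k v → Dec (Within k v)
  within? zero    v = v ≟ x
  within? (suc k) v = within? k v ⊎-dec any? (λ u → within? k u ×-dec T? (adj G u v))

  within-mono : ∀ {j k v} → j ≤ k → Within j v → Within k v
  within-mono {zero}  {zero}  _       w = w
  within-mono {zero}  {suc k} _       w = inj₁ (within-mono {zero} {k} z≤n w)
  within-mono {suc j} {suc k} (s≤s le) (inj₁ w)           = inj₁ (within-mono le w)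
  within-mono {suc j} {suc k} (s≤s le) (inj₂ (u , w , e)) = inj₂ (u , within-mono le w , e)

  walk-within : ∀ {u v k} → Walk G u v → Within k u → ∃ λ m → Within m v
  walk-within []      w = _ , w
  walk-within (e ∷ p) w = walk-within p (inj₂ (_ , w , e))

  least-within : ∀ v m → Within m v → Σ ℕ λ k → Within k v × (∀ j → Within j v → k ≤ j)
  least-within v zero    w = 0 , w , λ _ _ → z≤n
  least-within v (suc m) w with within? m v
  ... | yes w′ = least-within v m w′
  ... | no ¬w  = suc m , w , minimal
    where
      minimal : ∀ j → Within j v → suc m ≤ j
      minimal j wj with j ≤? m
      ... | yes j≤m = ⊥-elim (¬w (within-mono j≤m wj))
      ... | no  j≰m = ≰⇒> j≰m

  least-depth : ∀ v → Σ ℕ λ k → Within k v × (∀ j → Within j v → k ≤ j)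
  least-depth v = let (m , w) = walk-within {k = 0} (conn x v) refl in least-within v m w

  depth : Fin n → ℕ
  depth v = proj₁ (least-depth v)

  depth-within : ∀ v → Within (depth v) v
  depth-within v = proj₁ (proj₂ (least-depth v))

  depth-minimal : ∀ v j → Within j v → depth v ≤ j
  depth-minimal v = proj₂ (proj₂ (least-depth v))

  depth-zero : ∀ {v} → depth v ≡ 0 → v ≡ x
  depth-zero {v} d≡0 = subst (λ m → Within m v) d≡0 (depth-within v)

  depth-edge : ∀ {u v} → E u v → depth v ≤ suc (depth u)
  depth-edge {u} {v} e = depth-minimal v (suc (depth u)) (inj₂ (u , depth-within u , e))

  parent-exists : ∀ v k → depth v ≡ suc k → ∃ λ u → depth u ≡ k × E u v
  parent-exists v k dv with subst (λ m → Within m v) dv (depth-within v)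
  ... | inj₁ w = ⊥-elim (<-irrefl refl (subst (_≤ k) dv (depth-minimal v k w)))
  ... | inj₂ (u , w , e) = u , ≤-antisym (depth-minimal u k w) k≤du , e
    where
      k≤du : k ≤ depth u
      k≤du = s≤s⁻¹ (subst (_≤ suc (depth u)) dv (depth-edge e))

  -- The parent of a non-root vertex (the root is its own parent), defined
  -- by cases on a value m of the depth.
  parent-at : ∀ v m → depth v ≡ m → Fin n
  parent-at v zero    _  = v
  parent-at v (suc k) dv = proj₁ (parent-exists v k dv)

  parent : Fin n → Fin n
  parent v = parent-at v (depth v) refl

  parent-at-spec : ∀ v m (dv : depth v ≡ m) k → m ≡ suc k →
                   depth (parent-at v m dv) ≡ k × E (parent-at v m dv) v
  parent-at-spec v (suc k) dv .k refl = proj₂ (parent-exists v k dv)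

  parent-spec : ∀ v k → depth v ≡ suc k → depth (parent v) ≡ k × E (parent v) v
  parent-spec v k = parent-at-spec v (depth v) refl k

  within-aut : ∀ σ → IsRootedAut G x σ → ∀ k v → Within k v → Within k (σ ⟨$⟩ʳ v)
  within-aut σ aut zero    v w                  = trans (cong (σ ⟨$⟩ʳ_) w) (proj₂ aut)
  within-aut σ aut (suc k) v (inj₁ w)           = inj₁ (within-aut σ aut k v w)
  within-aut σ aut (suc k) v (inj₂ (u , w , e)) =
    inj₂ (σ ⟨$⟩ʳ u , within-aut σ aut k u w , aut-edge G x σ aut e)

  depth-aut-≤ : ∀ σ → IsRootedAut G x σ → ∀ v → depth (σ ⟨$⟩ʳ v) ≤ depth v
  depth-aut-≤ σ aut v = depth-minimal (σ ⟨$⟩ʳ v) (depth v) (within-aut σ aut (depth v) v (depth-within v))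

  depth-aut : ∀ σ → IsRootedAut G x σ → ∀ v → depth (σ ⟨$⟩ʳ v) ≡ depth v
  depth-aut σ aut v = ≤-antisym (depth-aut-≤ σ aut v)
    (subst (λ w → depth w ≤ depth (σ ⟨$⟩ʳ v)) (inverseˡ σ)
      (depth-aut-≤ (flip σ) (inverse-aut G x σ aut) (σ ⟨$⟩ʳ v)))

module Tree {n : ℕ} (G : Graph n) (x : Fin n) (tree : IsTree G) where

  open Depth G x (proj₁ tree) public

  shallower-≢ : ∀ {y z k} → depth y ≡ k → suc k ≤ depth z → y ≢ z
  shallower-≢ dy deeper refl = <-irrefl refl (subst (suc _ ≤_) dy deeper)

  close-cycle : ∀ {q} a b mid → E q a → E q b → All (q ≢_) (a ∷ mid ∷ʳ b) →
                Unique (a ∷ mid ∷ʳ b) → Linked E (a ∷ mid ∷ʳ b) → ⊥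
  close-cycle {q} a b mid qa qb q∉ uniq linked =
    proj₂ tree q (a ∷ mid ∷ʳ b)
      ( s≤s (length-∷ʳ-positive mid b)
      , q∉ ∷ uniq
      , qa ∷ Linked-∷ʳ (a ∷ mid) b q linked (edge-sym G qb))

  -- Two distinct vertices of depth k are not joined by a simple path all of
  -- whose vertices have depth ≥ k: their parents either close a cycle (if
  -- equal) or are joined by such a path one level higher.
  no-level-bridge : ∀ k a b mid → depth a ≡ k → depth b ≡ k → a ≢ b →
                    Unique (a ∷ mid ∷ʳ b) → Linked E (a ∷ mid ∷ʳ b) →
                    All (λ z → k ≤ depth z) (a ∷ mid ∷ʳ b) → ⊥
  no-level-bridge zero a b mid da db a≢b _ _ _ =
    a≢b (trans (depth-zero da) (sym (depth-zero db)))
  no-level-bridge (suc k) a b mid da db a≢b uniq linked deep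
    with parent-spec a k da | parent-spec b k db | parent a ≟ parent b
  ... | dpa , pa→a | dpb , pb→b | yes pa≡pb =
    close-cycle a b mid pa→a (subst (λ w → E w b) (sym pa≡pb) pb→b)
      (All.map (shallower-≢ dpa) deep) uniq linked
  ... | dpa , pa→a | dpb , pb→b | no pa≢pb =
    no-level-bridge k (parent a) (parent b) path dpa dpb pa≢pb uniq′ linked′ deep′
    where
      path = a ∷ mid ∷ʳ b
      uniq′ : Unique (parent a ∷ path ∷ʳ parent b)
      uniq′ = ∷ʳ⁺ (All.map (shallower-≢ dpa) deep) pa≢pb
            ∷ Unique-∷ʳ path (parent b) uniq (All.map (λ deeper → ≢-sym (shallower-≢ dpb deeper)) deep)
      linked′ : Linked E (parent a ∷ path ∷ʳ parent b)
      linked′ = pa→a ∷ Linked-∷ʳ (a ∷ mid) b (parent b) linked (edge-sym G pb→b)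
      deep′ : All (λ z → k ≤ depth z) (parent a ∷ path ∷ʳ parent b)
      deep′ = ≤-reflexive (sym dpa) ∷ ∷ʳ⁺ (All.map (≤-trans (n≤1+n k)) deep) (≤-reflexive (sym dpb))

  edge-depth-≢ : ∀ {u v} → E u v → depth u ≢ depth v
  edge-depth-≢ {u} {v} e du≡dv =
    no-level-bridge (depth u) u v [] refl (sym du≡dv) (edge-≢ G e)
      ((edge-≢ G e ∷ []) ∷ [] ∷ []) (e ∷ [-]) (≤-refl ∷ ≤-reflexive du≡dv ∷ [])

  edge-levels : ∀ {u v} → E u v → depth v ≡ suc (depth u) ⊎ depth u ≡ suc (depth v)
  edge-levels {u} {v} e with <-cmp (depth u) (depth v)
  ... | tri< du<dv _ _ = inj₁ (≤-antisym (depth-edge e) du<dv)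
  ... | tri≈ _ du≡dv _ = ⊥-elim (edge-depth-≢ e du≡dv)
  ... | tri> _ _ dv<du = inj₂ (≤-antisym (depth-edge (edge-sym G e)) dv<du)

  parent-unique : ∀ {u w v k} → depth u ≡ k → depth w ≡ k → depth v ≡ suc k →
                  E u v → E w v → u ≡ w
  parent-unique {u} {w} {v} {k} du dw dv uv wv with u ≟ w
  ... | yes u≡w = u≡w
  ... | no  u≢w = ⊥-elim (no-level-bridge k u w (v ∷ []) du dw u≢w uniq (uv ∷ edge-sym G wv ∷ [-]) deep)
    where
      v-deeper : suc k ≤ depth v
      v-deeper = ≤-reflexive (sym dv)
      uniq : Unique (u ∷ v ∷ w ∷ [])
      uniq = (shallower-≢ du v-deeper ∷ u≢w ∷ [])
           ∷ (≢-sym (shallower-≢ dw v-deeper) ∷ [])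
           ∷ [] ∷ []
      deep : All (λ z → k ≤ depth z) (u ∷ v ∷ w ∷ [])
      deep = ≤-reflexive (sym du) ∷ ≤-trans (n≤1+n k) v-deeper ∷ ≤-reflexive (sym dw) ∷ []

  parent-is : ∀ {u v} → E u v → depth v ≡ suc (depth u) → u ≡ parent v
  parent-is {u} {v} uv dv =
    let (dp , pv) = parent-spec v (depth u) dv in parent-unique refl dp dv uv pv

  parent-aut : ∀ σ → IsRootedAut G x σ → ∀ {v k} → depth v ≡ suc k →
               parent (σ ⟨$⟩ʳ v) ≡ σ ⟨$⟩ʳ parent v
  parent-aut σ aut {v} {k} dv = sym (parent-is (aut-edge G x σ aut pv→v) levels)
    where
      dpv   = proj₁ (parent-spec v k dv)
      pv→v  = proj₂ (parent-spec v k dv)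
      levels : depth (σ ⟨$⟩ʳ v) ≡ suc (depth (σ ⟨$⟩ʳ parent v))
      levels = trans (depth-aut σ aut v) (trans dv (cong suc (sym (trans (depth-aut σ aut (parent v)) dpv))))

module Avoid (d : ℕ) where

  old : Fin d → Fin (d + 1)
  old i = i ↑ˡ 1

  fresh : Fin (d + 1)
  fresh = d ↑ʳ Fin.zero

  old≢fresh : ∀ i → old i ≢ fresh
  old≢fresh i eq with trans (sym (splitAt-↑ˡ d i 1)) (trans (cong (splitAt d) eq) (splitAt-↑ʳ d 1 Fin.zero))
  ... | ()

  avoid : Fin d → Fin (d + 1) → Fin (d + 1)
  avoid a q with old a ≟ q
  ... | yes _ = fresh
  ... | no  _ = old a

  avoid-≢ : ∀ a q → avoid a q ≢ q
  avoid-≢ a q with old a ≟ q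
  ... | yes a≡q = λ fresh≡q → old≢fresh a (trans a≡q (sym fresh≡q))
  ... | no  a≢q = a≢q

  avoid-injective : ∀ a b q → avoid a q ≡ avoid b q → a ≡ b
  avoid-injective a b q with old a ≟ q | old b ≟ q
  ... | yes a≡q | yes b≡q = λ _ → ↑ˡ-injective 1 a b (trans a≡q (sym b≡q))
  ... | yes _   | no  _   = λ fresh≡b → ⊥-elim (old≢fresh b (sym fresh≡b))
  ... | no  _   | yes _   = λ a≡fresh → ⊥-elim (old≢fresh a a≡fresh)
  ... | no  _   | no  _   = ↑ˡ-injective 1 a b

module Repaint {n : ℕ} (G : Graph n) (x : Fin n) (tree : IsTree G) (d : ℕ) (c : Coloring n d) where

  open Tree G x tree
  open Avoid d
  open ≡-Reasoning

  -- paint k v: the new colour of v, computed as if v had depth k.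
  paint : ℕ → Fin n → Fin (d + 1)
  paint zero    v = old (c v)
  paint (suc k) v = avoid (c v) (paint k (parent v))

  repaint : Coloring n (d + 1)
  repaint v = paint (depth v) v

  repaint-child : ∀ {v k} → depth v ≡ suc k → repaint v ≡ avoid (c v) (repaint (parent v))
  repaint-child {v} {k} dv = begin
    paint (depth v) v                                   ≡⟨ cong (λ m → paint m v) dv ⟩
    avoid (c v) (paint k (parent v))                    ≡⟨ cong (λ m → avoid (c v) (paint m (parent v))) (sym dp) ⟩
    avoid (c v) (paint (depth (parent v)) (parent v))   ∎
    where dp = proj₁ (parent-spec v k dv)

  child-≢ : ∀ {u v} → E u v → depth v ≡ suc (depth u) → repaint u ≢ repaint v
  child-≢ {u} {v} uv dv ru≡rv = avoid-≢ (c v) (repaint (parent v)) (begin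
    avoid (c v) (repaint (parent v))   ≡⟨ sym (repaint-child dv) ⟩
    repaint v                          ≡⟨ sym ru≡rv ⟩
    repaint u                          ≡⟨ cong repaint (parent-is uv dv) ⟩
    repaint (parent v)                 ∎)

  repaint-proper : Proper G repaint
  repaint-proper u v uv with edge-levels uv
  ... | inj₁ dv = child-≢ uv dv
  ... | inj₂ du = λ ru≡rv → child-≢ (edge-sym G uv) du (sym ru≡rv)

  preserves-old : ∀ σ → IsRootedAut G x σ → (∀ v → repaint (σ ⟨$⟩ʳ v) ≡ repaint v) →
                  ∀ v → c (σ ⟨$⟩ʳ v) ≡ c v
  preserves-old σ aut pres v with depth v in dv
  ... | zero  = cong c (trans (cong (σ ⟨$⟩ʳ_) v≡x) (trans (proj₂ aut) (sym v≡x)))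
    where v≡x = depth-zero dv
  ... | suc k = avoid-injective (c (σ ⟨$⟩ʳ v)) (c v) (repaint (parent v)) (begin
    avoid (c σv) (repaint (parent v))             ≡⟨ cong (avoid (c σv)) (sym (pres (parent v))) ⟩
    avoid (c σv) (repaint (σ ⟨$⟩ʳ parent v))      ≡⟨ cong (λ w → avoid (c σv) (repaint w)) (sym (parent-aut σ aut dv)) ⟩
    avoid (c σv) (repaint (parent σv))            ≡⟨ sym (repaint-child (trans (depth-aut σ aut v) dv)) ⟩
    repaint σv                                    ≡⟨ pres v ⟩
    repaint v                                     ≡⟨ repaint-child dv ⟩
    avoid (c v) (repaint (parent v))              ∎)
    where σv = σ ⟨$⟩ʳ v

  repaint-distinguishing : Distinguishing G x c → Distinguishing G x repaint
  repaint-distinguishing c-dist σ aut pres = c-dist σ aut (preserves-old σ aut pres)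

theorem12 : ∀ {n : ℕ} (T : Graph n) (x : Fin n) → IsTree T →
    ∀ (d χ : ℕ) → IsDistNumber T x d → IsDistChromNumber T x χ → χ ≤ d + 1
theorem12 T x tree d χ ((c , c-dist) , _) (_ , χ-minimal) =
  χ-minimal (d + 1) (repaint , repaint-proper , repaint-distinguishing c-dist)
  where open Repaint T x tree d c
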